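{- Let $n(k)$ denote the minimum number of vertices of an asymmetric $k$-graph with at least two vertices. Then $n(2)=6$, $n(3)=6$, and $n(k)=k+2$ for every integer $k\ge 4$.
   Context: A $k$-graph (a $k$-uniform hypergraph) is a pair $(X,\mathscr{M})$ with $X$ a finite set and $\mathscr{M}\subseteq\binom{X}{k}=\{A\subseteq X: |A|=k\}$. An automorphism is a bijection $\phi:X\to X$ with $\{\phi(M):M\in\mathscr{M}\}=\mathscr{M}$. A $k$-graph is asymmetric if its only automorphism is the identity, and symmetric otherwise. -}

module Defs where

open import Data.Nat using (ℕ; _≤_; _<_; _+_)
open import Data.Bool using (Bool; true)
open import Data.Fin using (Fin)
open import Data.Fin.Subset using (Subset; ∣_∣)
open import Data.Fin.Permutation using (Permutation′; _⟨$⟩ʳ_; _⟨$⟩ˡ_)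
open import Data.Vec using (tabulate; lookup)
open import Data.Product using (Σ; ∃; _×_)
open import Function.Bundles using (_⇔_)
open import Relation.Binary.PropositionalEquality using (_≡_)
open import Relation.Nullary using (¬_)

record KGraph (k m : ℕ) : Set where
  field
    edge    : Subset m → Bool
    uniform : ∀ A → edge A ≡ true → ∣ A ∣ ≡ k

open KGraph public

image : ∀ {m} → Permutation′ m → Subset m → Subset m
image φ A = tabulate (λ j → lookup A (φ ⟨$⟩ˡ j))

IsAutomorphism : ∀ {k m} → KGraph k m → Permutation′ m → Set
IsAutomorphism G φ =
  ∀ B → (edge G B ≡ true) ⇔ (∃ λ A → edge G A ≡ true × image φ A ≡ B)

Asymmetric : ∀ {k m} → KGraph k m → Set
Asymmetric {m = m} G =
  (φ : Permutation′ m) → IsAutomorphism G φ → ∀ (i : Fin m) → φ ⟨$⟩ʳ i ≡ i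

IsMinAsymOrder : ℕ → ℕ → Set
IsMinAsymOrder k N =
  2 ≤ N
  × (Σ (KGraph k N) Asymmetric)
  × (∀ m → 2 ≤ m → m < N → ¬ Σ (KGraph k m) Asymmetric)

-- On at most k + 1 vertices every k-set is either the whole vertex set or the complement
-- of a vertex, so some transposition of two vertices of equal status is an automorphism.
-- The remaining small cases, 2-graphs on four and five vertices and 3-graphs on five
-- vertices (whose complements are 2-graphs), are settled by a search, over all edge sets,
-- for an automorphism among the transpositions and double transpositions.
-- Conversely, the path 0 — 1 — ⋯ — (5 + r) with the chord 1 — 3 is a rigid graph: an
-- automorphism must fix the end 0 (the other end has no neighbour of degree three), and
-- then, walking along the path, every vertex. Its complementary (4 + r)-graph is then
-- asymmetric as well, and for k = 3 an explicit 3-graph on six vertices is checked to be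
-- rigid by enumerating all permutations.
module Submission where

open import Defs
open import Data.Bool using (Bool; true; false; not; _∨_)
open import Data.Bool.Properties using (not-involutive; ⇔→≡) renaming (_≟_ to _Bool-≟_)
open import Data.Nat using (ℕ; zero; suc; _+_; _≤_; _<_; z≤n; s≤s; z<s; s<s)
  renaming (_<?_ to _ℕ-<?_)
open import Data.Nat.Properties
  using (+-comm; +-cancelˡ-≡; m+[n∸m]≡n; ≤-refl; ≤-antisym; ≤-trans; ≤-reflexive; n≤1+n;
         m≤n⇒m<n∨m≡n; ≤∧≢⇒<; <-trans; <⇒≢; n<1+n; m<n+m; n≮n; m+n≮m; suc-injective;
         _≤?_; ≰⇒>; m≤n⇒∃[o]m+o≡n)
  renaming (_≟_ to _ℕ-≟_)
open import Data.Fin using (Fin; zero; suc; toℕ; fromℕ<; #_; _≟_; _<?_) renaming (_<_ to _<ᶠ_)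
open import Data.Fin.Properties using (any?; toℕ-injective; toℕ<n; toℕ-fromℕ<; fromℕ<-toℕ)
  renaming (all? to all?ᶠ)
open import Data.Fin.Subset using (Subset; inside; outside; ∣_∣; ⊤; ⁅_⁆; _∪_; ∁)
  renaming (_∈_ to _∈ₛ_)
open import Data.Fin.Subset.Properties
  using (∣p∣≤n; ∣p∣≡n⇒p≡⊤; ∣∁p∣≡n∸∣p∣; ∣⁅x⁆∣≡1; ∪-identityˡ; ∪-identityʳ;
         x∈p∪q⁻; x∈p∪q⁺; x∈⁅x⁆; x∈⁅y⁆⇒x≡y)
open import Data.Fin.Permutation
  using (Permutation′; _⟨$⟩ʳ_; _⟨$⟩ˡ_; flip; inverseˡ; inverseʳ; transpose; _∘ₚ_)
import Data.Fin.Permutation.Components as PC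
open import Data.Vec using (Vec; []; _∷_; tabulate; lookup)
open import Data.Vec.Properties
  using (tabulate-cong; lookup∘tabulate; tabulate∘lookup; lookup-map; lookup-zipWith;
         lookup-replicate; map-replicate)
  renaming (≡-dec to Vec-≡-dec)
import Data.Vec.Relation.Unary.All as VecAll
open import Data.Vec.Relation.Unary.AllPairs using (_∷_)
import Data.Vec.Relation.Unary.AllPairs as AllPairs
open import Data.Vec.Relation.Unary.Unique.Propositional using (Unique)
open import Data.Vec.Relation.Unary.Unique.Propositional.Properties using (tabulate⁺)
open import Data.List using (List; []; _∷_; _++_; map; filter; allFin; cartesianProduct)
open import Data.List.Membership.Propositional using (_∈_)
open import Data.List.Membership.Propositional.Properties
  using (∈-map⁺; ∈-++⁺ˡ; ∈-++⁺ʳ; ∈-filter⁺; ∈-filter⁻)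
open import Data.List.Relation.Unary.All using (All; []; _∷_)
import Data.List.Relation.Unary.All as All
import Data.List.Relation.Unary.All.Properties as All
open import Data.List.Relation.Unary.Any using (Any; here)
import Data.List.Relation.Unary.Any as Any
open import Data.Product using (Σ; ∃; _×_; _,_; proj₂; uncurry)
open import Data.Sum using (_⊎_; inj₁; inj₂)
import Data.Sum as Sum
open import Function.Base using (_∘_; case_of_)
open import Function.Bundles using (_⇔_; mk⇔; Equivalence)
open import Relation.Binary.PropositionalEquality
open import Relation.Nullary
  using (¬_; ¬?; Dec; does; yes; no; map′; contradiction; _×-dec_; _⊎-dec_; _→-dec_)
open import Relation.Nullary.Decidable using (toWitness; dec-true; dec-false; does-⇔)
open import Relation.Unary using (Decidable)

does⇒ : ∀ {A : Set} (a? : Dec A) → does a? ≡ true → A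
does⇒ (yes a) _ = a

subset-ext : ∀ {n} {A B : Subset n} → (∀ x → lookup A x ≡ lookup B x) → A ≡ B
subset-ext {A = A} {B} eq =
  trans (sym (tabulate∘lookup A)) (trans (tabulate-cong eq) (tabulate∘lookup B))

lookup-⁅⁆ : ∀ {n} (i x : Fin n) → lookup ⁅ i ⁆ x ≡ does (x ≟ i)
lookup-⁅⁆ zero    zero    = refl
lookup-⁅⁆ zero    (suc x) = lookup-replicate x false
lookup-⁅⁆ (suc i) zero    = refl
lookup-⁅⁆ (suc i) (suc x) = lookup-⁅⁆ i x

∁-involutive : ∀ {n} (A : Subset n) → ∁ (∁ A) ≡ A
∁-involutive []      = refl
∁-involutive (x ∷ A) = cong₂ _∷_ (not-involutive x) (∁-involutive A)

∣p∣+∣∁p∣≡n : ∀ {n} (A : Subset n) → ∣ A ∣ + ∣ ∁ A ∣ ≡ n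
∣p∣+∣∁p∣≡n A rewrite ∣∁p∣≡n∸∣p∣ A = m+[n∸m]≡n (∣p∣≤n A)

∣⁅i⁆∪⁅j⁆∣≡2 : ∀ {n} (i j : Fin n) → i ≢ j → ∣ ⁅ i ⁆ ∪ ⁅ j ⁆ ∣ ≡ 2
∣⁅i⁆∪⁅j⁆∣≡2 zero    zero    i≢j = contradiction refl i≢j
∣⁅i⁆∪⁅j⁆∣≡2 zero    (suc j) _   = cong suc (trans (cong ∣_∣ (∪-identityˡ ⁅ j ⁆)) (∣⁅x⁆∣≡1 j))
∣⁅i⁆∪⁅j⁆∣≡2 (suc i) zero    _   = cong suc (trans (cong ∣_∣ (∪-identityʳ ⁅ i ⁆)) (∣⁅x⁆∣≡1 i))
∣⁅i⁆∪⁅j⁆∣≡2 (suc i) (suc j) i≢j = ∣⁅i⁆∪⁅j⁆∣≡2 i j (i≢j ∘ cong suc)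

∈-⁅⁆∪⁅⁆ : ∀ {n} {x : Fin n} i j → x ∈ₛ ⁅ i ⁆ ∪ ⁅ j ⁆ → x ≡ i ⊎ x ≡ j
∈-⁅⁆∪⁅⁆ i j x∈ with x∈p∪q⁻ ⁅ i ⁆ ⁅ j ⁆ x∈
... | inj₁ x∈⁅i⁆ = inj₁ (x∈⁅y⁆⇒x≡y i x∈⁅i⁆)
... | inj₂ x∈⁅j⁆ = inj₂ (x∈⁅y⁆⇒x≡y j x∈⁅j⁆)

∣p∣≡n⇒p≡∁⁅x⁆ : ∀ {n} (A : Subset (suc n)) → ∣ A ∣ ≡ n → ∃ λ x → A ≡ ∁ ⁅ x ⁆
∣p∣≡n⇒p≡∁⁅x⁆ (outside ∷ A) ∣A∣≡n =
  zero , cong (outside ∷_) (trans (∣p∣≡n⇒p≡⊤ ∣A∣≡n) (sym (map-replicate not false _)))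
∣p∣≡n⇒p≡∁⁅x⁆ {zero}  (inside ∷ A) ()
∣p∣≡n⇒p≡∁⁅x⁆ {suc n} (inside ∷ A) ∣A∣≡n with ∣p∣≡n⇒p≡∁⁅x⁆ A (suc-injective ∣A∣≡n)
... | x , refl = suc x , refl

module _ {m} (φ : Permutation′ m) where

  lookup-image : ∀ A x → lookup (image φ A) x ≡ lookup A (φ ⟨$⟩ˡ x)
  lookup-image A x = lookup∘tabulate _ x

  image-∁ : ∀ A → image φ (∁ A) ≡ ∁ (image φ A)
  image-∁ A = subset-ext λ x → begin
    lookup (image φ (∁ A)) x   ≡⟨ lookup-image (∁ A) x ⟩
    lookup (∁ A) (φ ⟨$⟩ˡ x)    ≡⟨ lookup-map (φ ⟨$⟩ˡ x) not A ⟩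
    not (lookup A (φ ⟨$⟩ˡ x))  ≡⟨ cong not (lookup-image A x) ⟨
    not (lookup (image φ A) x) ≡⟨ lookup-map x not (image φ A) ⟨
    lookup (∁ (image φ A)) x   ∎
    where open ≡-Reasoning

  image-∪ : ∀ A B → image φ (A ∪ B) ≡ image φ A ∪ image φ B
  image-∪ A B = subset-ext λ x → begin
    lookup (image φ (A ∪ B)) x                           ≡⟨ lookup-image (A ∪ B) x ⟩
    lookup (A ∪ B) (φ ⟨$⟩ˡ x)                            ≡⟨ lookup-zipWith _ (φ ⟨$⟩ˡ x) A B ⟩
    lookup A (φ ⟨$⟩ˡ x) ∨ lookup B (φ ⟨$⟩ˡ x)            ≡⟨ cong₂ _∨_ (lookup-image A x) (lookup-image B x) ⟨
    lookup (image φ A) x ∨ lookup (image φ B) x          ≡⟨ lookup-zipWith _ x (image φ A) (image φ B) ⟨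
    lookup (image φ A ∪ image φ B) x                     ∎
    where open ≡-Reasoning

  image-⁅⁆ : ∀ i → image φ ⁅ i ⁆ ≡ ⁅ φ ⟨$⟩ʳ i ⁆
  image-⁅⁆ i = subset-ext λ x → begin
    lookup (image φ ⁅ i ⁆) x ≡⟨ lookup-image ⁅ i ⁆ x ⟩
    lookup ⁅ i ⁆ (φ ⟨$⟩ˡ x)  ≡⟨ lookup-⁅⁆ i (φ ⟨$⟩ˡ x) ⟩
    does (φ ⟨$⟩ˡ x ≟ i)      ≡⟨ does-⇔ (mk⇔ moveʳ moveˡ) (φ ⟨$⟩ˡ x ≟ i) (x ≟ φ ⟨$⟩ʳ i) ⟩
    does (x ≟ φ ⟨$⟩ʳ i)      ≡⟨ lookup-⁅⁆ (φ ⟨$⟩ʳ i) x ⟨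
    lookup ⁅ φ ⟨$⟩ʳ i ⁆ x    ∎
    where
    open ≡-Reasoning
    moveʳ : ∀ {x} → φ ⟨$⟩ˡ x ≡ i → x ≡ φ ⟨$⟩ʳ i
    moveʳ refl = sym (inverseʳ φ)
    moveˡ : ∀ {x} → x ≡ φ ⟨$⟩ʳ i → φ ⟨$⟩ˡ x ≡ i
    moveˡ refl = inverseˡ φ

  image-⁅⁆∪⁅⁆ : ∀ i j → image φ (⁅ i ⁆ ∪ ⁅ j ⁆) ≡ ⁅ φ ⟨$⟩ʳ i ⁆ ∪ ⁅ φ ⟨$⟩ʳ j ⁆
  image-⁅⁆∪⁅⁆ i j = trans (image-∪ ⁅ i ⁆ ⁅ j ⁆) (cong₂ _∪_ (image-⁅⁆ i) (image-⁅⁆ j))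

  image-⊤ : image φ ⊤ ≡ ⊤
  image-⊤ = subset-ext λ x →
    trans (lookup-image ⊤ x) (trans (lookup-replicate (φ ⟨$⟩ˡ x) true) (sym (lookup-replicate x true)))

  image-flip-image : ∀ A → image (flip φ) (image φ A) ≡ A
  image-flip-image A = subset-ext λ x →
    trans (lookup∘tabulate _ x) (trans (lookup-image A (φ ⟨$⟩ʳ x)) (cong (lookup A) (inverseˡ φ)))

  image-image-flip : ∀ A → image φ (image (flip φ) A) ≡ A
  image-image-flip A = subset-ext λ x →
    trans (lookup-image (image (flip φ) A) x)
          (trans (lookup∘tabulate _ (φ ⟨$⟩ˡ x)) (cong (lookup A) (inverseʳ φ)))

permutation-injective : ∀ {n} (φ : Permutation′ n) {i j} → φ ⟨$⟩ʳ i ≡ φ ⟨$⟩ʳ j → i ≡ j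
permutation-injective φ eq = trans (sym (inverseˡ φ)) (trans (cong (φ ⟨$⟩ˡ_) eq) (inverseˡ φ))

transpose-sends : ∀ {n} (i j : Fin n) → PC.transpose i j i ≡ j
transpose-sends i j rewrite dec-true (i ≟ i) refl = refl

transpose-respects : ∀ {n} {A : Set} (f : Fin n → A) {i j} → f i ≡ f j → ∀ x → f (PC.transpose i j x) ≡ f x
transpose-respects f {i} {j} fi≡fj x with x ≟ i | x ≟ j
... | yes refl | _        = sym fi≡fj
... | no _     | yes refl rewrite dec-true (j ≟ j) refl = fi≡fj
... | no _     | no x≢j   rewrite dec-false (x ≟ j) x≢j = refl

module _ {k m} (G : KGraph k m) where

  IsEdge : Subset m → Set
  IsEdge A = edge G A ≡ true

  isEdge? : Decidable IsEdge
  isEdge? A = edge G A Bool-≟ true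

  EdgeInvariant : Permutation′ m → Set
  EdgeInvariant φ = ∀ A → edge G (image φ A) ≡ edge G A

  EdgePreserving : Permutation′ m → Set
  EdgePreserving φ = ∀ A → IsEdge A → IsEdge (image φ A)

  automorphism⇒edge-invariant : ∀ φ → IsAutomorphism G φ → EdgeInvariant φ
  automorphism⇒edge-invariant φ aut A =
    ⇔→≡ (mk⇔ reflect (λ e → Equivalence.from (aut _) (A , e , refl)))
    where
    reflect : IsEdge (image φ A) → IsEdge A
    reflect e with Equivalence.to (aut _) e
    ... | A′ , e′ , φA′≡φA = subst IsEdge A′≡A e′
      where
      A′≡A : A′ ≡ A
      A′≡A = trans (sym (image-flip-image φ A′))
               (trans (cong (image (flip φ)) φA′≡φA) (image-flip-image φ A))

  edge-invariant⇒automorphism : ∀ φ → EdgeInvariant φ → IsAutomorphism G φ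
  edge-invariant⇒automorphism φ inv B = mk⇔
    (λ e → image (flip φ) B
         , trans (sym (inv _)) (trans (cong (edge G) (image-image-flip φ B)) e)
         , image-image-flip φ B)
    (λ { (A , e , φA≡B) → subst IsEdge φA≡B (trans (inv A) e) })

  edge-preserving⇒automorphism : ∀ φ → EdgePreserving φ → EdgePreserving (flip φ) → IsAutomorphism G φ
  edge-preserving⇒automorphism φ pres pres⁻¹ = edge-invariant⇒automorphism φ λ A →
    ⇔→≡ (mk⇔ (λ e → subst IsEdge (image-flip-image φ A) (pres⁻¹ _ e)) (pres A))

-- At most k + 1 vertices

module _ {k m} (G : KGraph k m) where

  m≤k⇒edge≡⊤ : m ≤ k → ∀ A → IsEdge G A → A ≡ ⊤
  m≤k⇒edge≡⊤ m≤k A e =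
    ∣p∣≡n⇒p≡⊤ (≤-antisym (∣p∣≤n A) (≤-trans m≤k (≤-reflexive (sym (uniform G A e)))))

  m≤k⇒edge-preserving : m ≤ k → ∀ φ → EdgePreserving G φ
  m≤k⇒edge-preserving m≤k φ A e = subst (IsEdge G) (sym φA≡A) e
    where
    A≡⊤ : A ≡ ⊤
    A≡⊤ = m≤k⇒edge≡⊤ m≤k A e
    φA≡A : image φ A ≡ A
    φA≡A = trans (cong (image φ) A≡⊤) (trans (image-⊤ φ) (sym A≡⊤))

m≤k⇒symmetric : ∀ {k r} → 2 + r ≤ k → (G : KGraph k (2 + r)) → ¬ Asymmetric G
m≤k⇒symmetric {r = r} m≤k G asym =
  case asym σ (edge-preserving⇒automorphism G σ (pres σ) (pres (flip σ))) zero of λ ()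
  where
  σ : Permutation′ (2 + r)
  σ = transpose zero (suc zero)
  pres : ∀ φ → EdgePreserving G φ
  pres = m≤k⇒edge-preserving G m≤k

module _ {k} (G : KGraph k (suc k)) where

  status : Fin (suc k) → Bool
  status x = edge G (∁ ⁅ x ⁆)

  status-preserving⇒edge-preserving : ∀ φ → (∀ x → status (φ ⟨$⟩ʳ x) ≡ status x) → EdgePreserving G φ
  status-preserving⇒edge-preserving φ pres A e with ∣p∣≡n⇒p≡∁⁅x⁆ A (uniform G A e)
  ... | x , refl = begin
    edge G (image φ (∁ ⁅ x ⁆)) ≡⟨ cong (edge G) (trans (image-∁ φ ⁅ x ⁆) (cong ∁ (image-⁅⁆ φ x))) ⟩
    status (φ ⟨$⟩ʳ x)          ≡⟨ pres x ⟩
    status x                   ≡⟨ e ⟩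
    true                       ∎
    where open ≡-Reasoning

  twins⇒symmetric : ∀ {i j} → i ≢ j → status i ≡ status j → ¬ Asymmetric G
  twins⇒symmetric {i} {j} i≢j same asym = i≢j (sym (trans (sym (transpose-sends i j)) (asym σ aut i)))
    where
    σ : Permutation′ (suc k)
    σ = transpose i j
    aut : IsAutomorphism G σ
    aut = edge-preserving⇒automorphism G σ
      (status-preserving⇒edge-preserving σ (transpose-respects status same))
      (status-preserving⇒edge-preserving (flip σ) (transpose-respects status (sym same)))

bool-pigeonhole : ∀ (a b c : Bool) → a ≡ b ⊎ a ≡ c ⊎ b ≡ c
bool-pigeonhole true  true  _     = inj₁ refl
bool-pigeonhole false false _     = inj₁ refl
bool-pigeonhole true  false true  = inj₂ (inj₁ refl)
bool-pigeonhole false true  false = inj₂ (inj₁ refl)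
bool-pigeonhole true  false false = inj₂ (inj₂ refl)
bool-pigeonhole false true  true  = inj₂ (inj₂ refl)

m≡k+1⇒symmetric : ∀ {r} (G : KGraph (2 + r) (3 + r)) → ¬ Asymmetric G
m≡k+1⇒symmetric G with bool-pigeonhole (status G zero) (status G (suc zero)) (status G (suc (suc zero)))
... | inj₁ eq        = twins⇒symmetric G {zero}     {suc zero}       (λ ()) eq
... | inj₂ (inj₁ eq) = twins⇒symmetric G {zero}     {suc (suc zero)} (λ ()) eq
... | inj₂ (inj₂ eq) = twins⇒symmetric G {suc zero} {suc (suc zero)} (λ ()) eq

few-vertices⇒symmetric : ∀ {k m} → 2 ≤ k → 2 ≤ m → m ≤ suc k → ¬ Σ (KGraph k m) Asymmetric
few-vertices⇒symmetric {suc zero} (s≤s ())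
few-vertices⇒symmetric {_} {suc zero} _ (s≤s ())
few-vertices⇒symmetric {suc (suc k)} {suc (suc r)} _ _ m≤1+k (G , asym) with m≤n⇒m<n∨m≡n m≤1+k
... | inj₁ (s≤s m≤k) = m≤k⇒symmetric m≤k G asym
... | inj₂ refl      = m≡k+1⇒symmetric G asym

-- Complementary k-graphs

complement : ∀ {k l m} → k + l ≡ m → KGraph k m → KGraph l m
complement {k} {l} {m} k+l≡m G = record { edge = edge G ∘ ∁ ; uniform = uniform′ }
  where
  uniform′ : ∀ A → edge G (∁ A) ≡ true → ∣ A ∣ ≡ l
  uniform′ A e = +-cancelˡ-≡ k ∣ A ∣ l (begin
    k + ∣ A ∣       ≡⟨ cong (_+ ∣ A ∣) (uniform G (∁ A) e) ⟨
    ∣ ∁ A ∣ + ∣ A ∣ ≡⟨ +-comm ∣ ∁ A ∣ ∣ A ∣ ⟩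
    ∣ A ∣ + ∣ ∁ A ∣ ≡⟨ ∣p∣+∣∁p∣≡n A ⟩
    m               ≡⟨ k+l≡m ⟨
    k + l           ∎)
    where open ≡-Reasoning

complement-asymmetric : ∀ {k l m} (k+l≡m : k + l ≡ m) (G : KGraph k m) →
                        Asymmetric G → Asymmetric (complement k+l≡m G)
complement-asymmetric k+l≡m G asym φ aut = asym φ (edge-invariant⇒automorphism G φ invariant)
  where
  invariant : EdgeInvariant G φ
  invariant A = begin
    edge G (image φ A)         ≡⟨ cong (edge G) (trans (cong ∁ (image-∁ φ A)) (∁-involutive (image φ A))) ⟨
    edge G (∁ (image φ (∁ A))) ≡⟨ automorphism⇒edge-invariant (complement k+l≡m G) φ aut (∁ A) ⟩
    edge G (∁ (∁ A))           ≡⟨ cong (edge G) (∁-involutive A) ⟩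
    edge G A                   ∎
    where open ≡-Reasoning

-- Exhaustive search

_∈ₗ?_ : ∀ {m} (A : Subset m) (Es : List (Subset m)) → Dec (A ∈ Es)
A ∈ₗ? Es = Any.any? (Vec-≡-dec _Bool-≟_ A) Es

allSubsets : ∀ m → List (Subset m)
allSubsets zero    = [] ∷ []
allSubsets (suc m) = map (inside ∷_) (allSubsets m) ++ map (outside ∷_) (allSubsets m)

∈-allSubsets : ∀ {m} (A : Subset m) → A ∈ allSubsets m
∈-allSubsets []            = here refl
∈-allSubsets (inside ∷ A)  = ∈-++⁺ˡ (∈-map⁺ (inside ∷_) (∈-allSubsets A))
∈-allSubsets (outside ∷ A) = ∈-++⁺ʳ _ (∈-map⁺ (outside ∷_) (∈-allSubsets A))

AllSublists : ∀ {A : Set} → (List A → Set) → List A → Set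
AllSublists Q []       = Q []
AllSublists Q (x ∷ xs) = AllSublists (Q ∘ (x ∷_)) xs × AllSublists Q xs

allSublists? : ∀ {A : Set} {Q : List A → Set} → (∀ ys → Dec (Q ys)) → ∀ xs → Dec (AllSublists Q xs)
allSublists? Q? []       = Q? []
allSublists? Q? (x ∷ xs) = allSublists? (Q? ∘ (x ∷_)) xs ×-dec allSublists? Q? xs

AllSublists⇒filter : ∀ {A : Set} (Q : List A → Set) {P : A → Set} (P? : Decidable P) xs →
                     AllSublists Q xs → Q (filter P? xs)
AllSublists⇒filter Q P? []       q          = q
AllSublists⇒filter Q P? (x ∷ xs) (q₁ , q₂) with does (P? x)
... | true  = AllSublists⇒filter (Q ∘ (x ∷_)) P? xs q₁
... | false = AllSublists⇒filter Q P? xs q₂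

module _ {m : ℕ} where

  MapsInto : Permutation′ m → List (Subset m) → Set
  MapsInto σ E = All (λ A → image σ A ∈ E) E

  -- Mapping E into itself in both directions makes σ an automorphism without any counting.
  Symmetry : List (Subset m) → Permutation′ m → Set
  Symmetry E σ = MapsInto σ E × MapsInto (flip σ) E × ∃ λ x → σ ⟨$⟩ʳ x ≢ x

  symmetry? : ∀ E σ → Dec (Symmetry E σ)
  symmetry? E σ = All.all? (λ A → image σ A ∈ₗ? E) E
          ×-dec All.all? (λ A → image (flip σ) A ∈ₗ? E) E
          ×-dec any? (λ x → ¬? (σ ⟨$⟩ʳ x ≟ x))

  subsetsOfSize : ℕ → List (Subset m)
  subsetsOfSize k = filter (λ A → ∣ A ∣ ℕ-≟ k) (allSubsets m)

  EveryKGraphHasSymmetryIn : ℕ → List (Permutation′ m) → Set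
  EveryKGraphHasSymmetryIn k σs = AllSublists (λ E → Any (Symmetry E) σs) (subsetsOfSize k)

  everyKGraphHasSymmetryIn? : ∀ k σs → Dec (EveryKGraphHasSymmetryIn k σs)
  everyKGraphHasSymmetryIn? k σs = allSublists? (λ E → Any.any? (symmetry? E) σs) (subsetsOfSize k)

  everyKGraphHasSymmetryIn⇒symmetric : ∀ {k} σs → EveryKGraphHasSymmetryIn k σs → ¬ Σ (KGraph k m) Asymmetric
  everyKGraphHasSymmetryIn⇒symmetric {k} σs search (G , asym)
    with Any.satisfied (AllSublists⇒filter _ (isEdge? G) (subsetsOfSize k) search)
  ... | σ , σE⊆E , σ⁻¹E⊆E , x , σx≢x = σx≢x (asym σ aut x)
    where
    E : List (Subset m)
    E = filter (isEdge? G) (subsetsOfSize k)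
    edge-preserving : ∀ φ → MapsInto φ E → EdgePreserving G φ
    edge-preserving φ φE⊆E A e = proj₂ (∈-filter⁻ (isEdge? G) {xs = subsetsOfSize k} (All.lookup φE⊆E A∈E))
      where
      A∈E : A ∈ E
      A∈E = ∈-filter⁺ (isEdge? G) (∈-filter⁺ (λ A → ∣ A ∣ ℕ-≟ k) (∈-allSubsets A) (uniform G A e)) e
    aut : IsAutomorphism G σ
    aut = edge-preserving⇒automorphism G σ (edge-preserving σ σE⊆E) (edge-preserving (flip σ) σ⁻¹E⊆E)

pairs : ∀ m → List (Fin m × Fin m)
pairs m = filter (uncurry _<?_) (cartesianProduct (allFin m) (allFin m))

Disjoint : ∀ {m} → (Fin m × Fin m) × (Fin m × Fin m) → Set
Disjoint ((i , j) , (k , l)) = i <ᶠ k × j ≢ k × j ≢ l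

disjoint? : ∀ {m} → Decidable (Disjoint {m})
disjoint? ((i , j) , (k , l)) = i <? k ×-dec ¬? (j ≟ k) ×-dec ¬? (j ≟ l)

involutions : ∀ m → List (Permutation′ m)
involutions m = map (uncurry transpose) (pairs m)
  ++ map (λ ((i , j) , (k , l)) → transpose i j ∘ₚ transpose k l)
         (filter disjoint? (cartesianProduct (pairs m) (pairs m)))

module AsKGraph {n} {_~_ : Fin n → Fin n → Set} (_~?_ : ∀ i j → Dec (i ~ j))
                (~-sym : ∀ {i j} → i ~ j → j ~ i) (~-irrefl : ∀ {i} → ¬ i ~ i) where

  IsLink : Subset n → Set
  IsLink B = ∃ λ i → ∃ λ j → i ~ j × B ≡ ⁅ i ⁆ ∪ ⁅ j ⁆

  isLink? : Decidable IsLink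
  isLink? B = any? λ i → any? λ j → i ~? j ×-dec Vec-≡-dec _Bool-≟_ B (⁅ i ⁆ ∪ ⁅ j ⁆)

  graph : KGraph 2 n
  graph = record { edge = does ∘ isLink? ; uniform = uniform′ }
    where
    uniform′ : ∀ B → does (isLink? B) ≡ true → ∣ B ∣ ≡ 2
    uniform′ B e with does⇒ (isLink? B) e
    ... | i , j , i~j , refl = ∣⁅i⁆∪⁅j⁆∣≡2 i j λ { refl → ~-irrefl i~j }

  link-⁅⁆∪⁅⁆ : ∀ {i j i′ j′} → ⁅ i′ ⁆ ∪ ⁅ j′ ⁆ ≡ ⁅ i ⁆ ∪ ⁅ j ⁆ → i′ ~ j′ → i ~ j
  link-⁅⁆∪⁅⁆ {i} {j} {i′} {j′} eq i′~j′
    with ∈-⁅⁆∪⁅⁆ i j (subst (i′ ∈ₛ_) eq (x∈p∪q⁺ (inj₁ (x∈⁅x⁆ i′))))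
       | ∈-⁅⁆∪⁅⁆ i j (subst (j′ ∈ₛ_) eq (x∈p∪q⁺ (inj₂ (x∈⁅x⁆ j′))))
  ... | inj₁ refl | inj₁ refl = contradiction i′~j′ ~-irrefl
  ... | inj₁ refl | inj₂ refl = i′~j′
  ... | inj₂ refl | inj₁ refl = ~-sym i′~j′
  ... | inj₂ refl | inj₂ refl = contradiction i′~j′ ~-irrefl

  edge⇔link : ∀ i j → edge graph (⁅ i ⁆ ∪ ⁅ j ⁆) ≡ true ⇔ i ~ j
  edge⇔link i j = mk⇔
    (λ e → let (i′ , j′ , i′~j′ , eq) = does⇒ (isLink? _) e in link-⁅⁆∪⁅⁆ (sym eq) i′~j′)
    (λ i~j → dec-true (isLink? _) (i , j , i~j , refl))

  automorphism⇒link⇔ : ∀ φ → IsAutomorphism graph φ → ∀ i j → i ~ j ⇔ (φ ⟨$⟩ʳ i) ~ (φ ⟨$⟩ʳ j)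
  automorphism⇒link⇔ φ aut i j = mk⇔
    (λ i~j → Equivalence.to (edge⇔link _ _) (trans same (Equivalence.from (edge⇔link i j) i~j)))
    (λ φi~φj → Equivalence.to (edge⇔link i j) (trans (sym same) (Equivalence.from (edge⇔link _ _) φi~φj)))
    where
    same : edge graph (⁅ φ ⟨$⟩ʳ i ⁆ ∪ ⁅ φ ⟨$⟩ʳ j ⁆) ≡ edge graph (⁅ i ⁆ ∪ ⁅ j ⁆)
    same = trans (cong (edge graph) (sym (image-⁅⁆∪⁅⁆ φ i j))) (automorphism⇒edge-invariant graph φ aut _)

-- A path with a chord

data Link : ℕ → ℕ → Set where
  step  : ∀ {a} → Link a (suc a)
  chord : Link 1 3

infix 4 _~_ _~?_

_~_ : ℕ → ℕ → Set
a ~ b = Link a b ⊎ Link b a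

~-sym : ∀ {a b} → a ~ b → b ~ a
~-sym = Sum.swap

~-irrefl : ∀ {a} → ¬ a ~ a
~-irrefl (inj₁ ())
~-irrefl (inj₂ ())

link-from : ∀ {a b} → b ≡ suc a ⊎ (a ≡ 1 × b ≡ 3) → Link a b
link-from (inj₁ refl)          = step
link-from (inj₂ (refl , refl)) = chord

link-to : ∀ {a b} → Link a b → b ≡ suc a ⊎ (a ≡ 1 × b ≡ 3)
link-to step  = inj₁ refl
link-to chord = inj₂ (refl , refl)

link? : ∀ a b → Dec (Link a b)
link? a b = map′ link-from link-to (b ℕ-≟ suc a ⊎-dec (a ℕ-≟ 1 ×-dec b ℕ-≟ 3))

_~?_ : ∀ a b → Dec (a ~ b)
a ~? b = link? a b ⊎-dec link? b a

~-0 : ∀ {b} → 0 ~ b → b ≡ 1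
~-0 (inj₁ step) = refl

~-1 : ∀ {b} → 1 ~ b → b ≡ 0 ⊎ b ≡ 2 ⊎ b ≡ 3
~-1 (inj₂ step)  = inj₁ refl
~-1 (inj₁ step)  = inj₂ (inj₁ refl)
~-1 (inj₁ chord) = inj₂ (inj₂ refl)

~-2 : ∀ {b} → 2 ~ b → b ≡ 1 ⊎ b ≡ 3
~-2 (inj₂ step) = inj₁ refl
~-2 (inj₁ step) = inj₂ refl

~-3 : ∀ {b} → 3 ~ b → b ≡ 2 ⊎ b ≡ 4 ⊎ b ≡ 1
~-3 (inj₂ step)  = inj₁ refl
~-3 (inj₁ step)  = inj₂ (inj₁ refl)
~-3 (inj₂ chord) = inj₂ (inj₂ refl)

~-4+ : ∀ {c b} → 4 + c ~ b → b ≡ 3 + c ⊎ b ≡ 5 + c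
~-4+ (inj₂ step) = inj₁ refl
~-4+ (inj₁ step) = inj₂ refl

module PathRigidity (r : ℕ) (h : ℕ → ℕ)
  (h-<         : ∀ {a} → a < 6 + r → h a < 6 + r)
  (h-injective : ∀ {a b} → a < 6 + r → b < 6 + r → h a ≡ h b → a ≡ b)
  (h-link      : ∀ {a b} → a < 6 + r → b < 6 + r → a ~ b → h a ~ h b)
  (h-link⁻     : ∀ {a c} → a < 6 + r → c < 6 + r → h a ~ c → ∃ λ b → b < 6 + r × a ~ b × c ≡ h b)
  where

  private
    n : ℕ
    n = 6 + r

    0<n : 0 < n
    0<n = z<s
    1<n : 1 < n
    1<n = s<s z<s
    2<n : 2 < n
    2<n = s<s (s<s z<s)
    3<n : 3 < n
    3<n = s<s (s<s (s<s z<s))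
    4<n : 4 < n
    4<n = s<s (s<s (s<s (s<s z<s)))

    pred< : ∀ {a} → suc a < n → a < n
    pred< = <-trans (n<1+n _)

    collide : ∀ {a b} {A : Set} → a < n → b < n → a ≢ b → h a ≡ h b → A
    collide a<n b<n a≢b ha≡hb = contradiction (h-injective a<n b<n ha≡hb) a≢b

    2+a≢a : ∀ {a} → 2 + a ≢ a
    2+a≢a {a} = ≢-sym (<⇒≢ (m<n+m a z<s))

  ~-h0⇒h1 : ∀ {c} → c < n → h 0 ~ c → c ≡ h 1
  ~-h0⇒h1 c<n h0~c with h-link⁻ 0<n c<n h0~c
  ... | b , _ , 0~b , refl = cong h (~-0 0~b)

  -- An inner vertex d + 1 has the two distinct neighbours d and d + 2.
  end-vertex : ∀ {c} → c < n → (∀ {d} → d < n → c ~ d → d ≡ h 1) → c ≡ 0 ⊎ c ≡ 5 + r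
  end-vertex {zero}  _     _ = inj₁ refl
  end-vertex {suc d} 1+d<n unique with d ℕ-≟ 4 + r
  ... | yes refl = inj₂ refl
  ... | no d≢4+r =
    contradiction (trans (unique 2+d<n (inj₁ step)) (sym (unique (pred< 1+d<n) (inj₂ step)))) 2+a≢a
    where
    2+d<n : 2 + d < n
    2+d<n = ≤∧≢⇒< 1+d<n (d≢4+r ∘ suc-injective ∘ suc-injective)

  -- From the far end, vertices 2 and 3 would both have to go to 3 + r.
  h0≢5+r : h 0 ≢ 5 + r
  h0≢5+r h0≡5+r =
    collide 2<n 3<n (λ ()) (trans (h≡3+r 2<n (inj₁ step) (λ ())) (sym (h≡3+r 3<n (inj₁ chord) (λ ()))))
    where
    h1≡4+r : h 1 ≡ 4 + r
    h1≡4+r with ~-4+ {suc r} (subst (_~ h 1) h0≡5+r (h-link 0<n 1<n (inj₁ step)))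
    ... | inj₁ h1≡4+r = h1≡4+r
    ... | inj₂ h1≡6+r = contradiction (subst (_< n) h1≡6+r (h-< 1<n)) (n≮n n)
    h≡3+r : ∀ {a} → a < n → 1 ~ a → a ≢ 0 → h a ≡ 3 + r
    h≡3+r a<n 1~a a≢0 with ~-4+ {r} (subst (_~ h _) h1≡4+r (h-link 1<n a<n 1~a))
    ... | inj₁ ha≡3+r = ha≡3+r
    ... | inj₂ ha≡5+r = collide a<n 0<n a≢0 (trans ha≡5+r (sym h0≡5+r))

  module FromZero (h0≡0 : h 0 ≡ 0) where

    h1≡1 : h 1 ≡ 1
    h1≡1 = ~-0 (subst (_~ h 1) h0≡0 (h-link 0<n 1<n (inj₁ step)))

    h≡2or3 : ∀ {a} → a < n → 1 ~ a → a ≢ 0 → h a ≡ 2 ⊎ h a ≡ 3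
    h≡2or3 a<n 1~a a≢0 with ~-1 (subst (_~ h _) h1≡1 (h-link 1<n a<n 1~a))
    ... | inj₁ ha≡0 = collide a<n 0<n a≢0 (trans ha≡0 (sym h0≡0))
    ... | inj₂ ha   = ha

    h3≡3 : h 3 ≡ 3
    h3≡3 with h≡2or3 3<n (inj₁ chord) (λ ())
    ... | inj₂ h3≡3 = h3≡3
    ... | inj₁ h3≡2 with ~-2 (subst (_~ h 4) h3≡2 (h-link 3<n 4<n (inj₁ step)))
    ...   | inj₁ h4≡1 = collide 4<n 1<n (λ ()) (trans h4≡1 (sym h1≡1))
    ...   | inj₂ h4≡3 with h≡2or3 2<n (inj₁ step) (λ ())
    ...     | inj₁ h2≡2 = collide 2<n 3<n (λ ()) (trans h2≡2 (sym h3≡2))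
    ...     | inj₂ h2≡3 = collide 2<n 4<n (λ ()) (trans h2≡3 (sym h4≡3))

    h2≡2 : h 2 ≡ 2
    h2≡2 with h≡2or3 2<n (inj₁ step) (λ ())
    ... | inj₁ h2≡2 = h2≡2
    ... | inj₂ h2≡3 = collide 2<n 3<n (λ ()) (trans h2≡3 (sym h3≡3))

    h4≡4 : h 4 ≡ 4
    h4≡4 with ~-3 (subst (_~ h 4) h3≡3 (h-link 3<n 4<n (inj₁ step)))
    ... | inj₁ h4≡2        = collide 4<n 2<n (λ ()) (trans h4≡2 (sym h2≡2))
    ... | inj₂ (inj₁ h4≡4) = h4≡4
    ... | inj₂ (inj₂ h4≡1) = collide 4<n 1<n (λ ()) (trans h4≡1 (sym h1≡1))

    h-fixes-pair : ∀ c → 4 + c < n → h (3 + c) ≡ 3 + c × h (4 + c) ≡ 4 + c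
    h-fixes-pair zero    _     = h3≡3 , h4≡4
    h-fixes-pair (suc c) 5+c<n with h-fixes-pair c (pred< 5+c<n)
    ... | h3+c≡3+c , h4+c≡4+c
      with ~-4+ (subst (_~ h (5 + c)) h4+c≡4+c (h-link (pred< 5+c<n) 5+c<n (inj₁ step)))
    ...   | inj₁ h5+c≡3+c = collide 5+c<n (pred< (pred< 5+c<n)) 2+a≢a (trans h5+c≡3+c (sym h3+c≡3+c))
    ...   | inj₂ h5+c≡5+c = h4+c≡4+c , h5+c≡5+c

    h-fixes : ∀ {a} → a < n → h a ≡ a
    h-fixes {0} _ = h0≡0
    h-fixes {1} _ = h1≡1
    h-fixes {2} _ = h2≡2
    h-fixes {3} _ = h3≡3
    h-fixes {suc (suc (suc (suc c)))} 4+c<n = proj₂ (h-fixes-pair c 4+c<n)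

  h-fixes : ∀ {a} → a < n → h a ≡ a
  h-fixes with end-vertex (h-< 0<n) ~-h0⇒h1
  ... | inj₁ h0≡0   = FromZero.h-fixes h0≡0
  ... | inj₂ h0≡5+r = contradiction h0≡5+r h0≢5+r

module PathWithChord (r : ℕ) =
  AsKGraph {n = 6 + r} {_~_ = λ i j → toℕ i ~ toℕ j} (λ i j → toℕ i ~? toℕ j) ~-sym ~-irrefl

pathWithChord-asymmetric : ∀ r → Asymmetric (PathWithChord.graph r)
pathWithChord-asymmetric r φ aut i = toℕ-injective (trans (sym (h-toℕ i)) (h-fixes (toℕ<n i)))
  where
  open PathWithChord r using (automorphism⇒link⇔)

  -- φ read on vertex numbers, so that the rigidity argument is arithmetic in ℕ.
  image-or-self : ∀ {a} → Dec (a < 6 + r) → ℕ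
  image-or-self (yes a<n)  = toℕ (φ ⟨$⟩ʳ fromℕ< a<n)
  image-or-self {a} (no _) = a

  h : ℕ → ℕ
  h a = image-or-self (a ℕ-<? 6 + r)

  h-fromℕ< : ∀ {a} (a<n : a < 6 + r) → h a ≡ toℕ (φ ⟨$⟩ʳ fromℕ< a<n)
  h-fromℕ< {a} a<n = image-or-self-yes (a ℕ-<? 6 + r)
    where
    image-or-self-yes : (a<n? : Dec (a < 6 + r)) → image-or-self a<n? ≡ toℕ (φ ⟨$⟩ʳ fromℕ< a<n)
    image-or-self-yes (yes _)  = refl
    image-or-self-yes (no a≮n) = contradiction a<n a≮n

  h-toℕ : ∀ i → h (toℕ i) ≡ toℕ (φ ⟨$⟩ʳ i)
  h-toℕ i = trans (h-fromℕ< (toℕ<n i)) (cong (toℕ ∘ (φ ⟨$⟩ʳ_)) (fromℕ<-toℕ i (toℕ<n i)))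

  h-< : ∀ {a} → a < 6 + r → h a < 6 + r
  h-< a<n = subst (_< 6 + r) (sym (h-fromℕ< a<n)) (toℕ<n _)

  h-injective : ∀ {a b} → a < 6 + r → b < 6 + r → h a ≡ h b → a ≡ b
  h-injective a<n b<n ha≡hb = trans (sym (toℕ-fromℕ< a<n)) (trans (cong toℕ i≡j) (toℕ-fromℕ< b<n))
    where
    i≡j : fromℕ< a<n ≡ fromℕ< b<n
    i≡j = permutation-injective φ (toℕ-injective (trans (sym (h-fromℕ< a<n)) (trans ha≡hb (h-fromℕ< b<n))))

  h-link : ∀ {a b} → a < 6 + r → b < 6 + r → a ~ b → h a ~ h b
  h-link a<n b<n a~b = subst₂ _~_ (sym (h-fromℕ< a<n)) (sym (h-fromℕ< b<n))
    (Equivalence.to (automorphism⇒link⇔ φ aut _ _)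
      (subst₂ _~_ (sym (toℕ-fromℕ< a<n)) (sym (toℕ-fromℕ< b<n)) a~b))

  h-link⁻ : ∀ {a c} → a < 6 + r → c < 6 + r → h a ~ c → ∃ λ b → b < 6 + r × a ~ b × c ≡ h b
  h-link⁻ {c = c} a<n c<n ha~c = toℕ j , toℕ<n j , subst (_~ toℕ j) (toℕ-fromℕ< a<n) i~j , sym hj≡c
    where
    j : Fin (6 + r)
    j = φ ⟨$⟩ˡ fromℕ< c<n
    hj≡c : h (toℕ j) ≡ c
    hj≡c = trans (h-toℕ j) (trans (cong toℕ (inverseʳ φ)) (toℕ-fromℕ< c<n))
    i~j : toℕ (fromℕ< a<n) ~ toℕ j
    i~j = Equivalence.from (automorphism⇒link⇔ φ aut (fromℕ< a<n) j)
      (subst₂ _~_ (h-fromℕ< a<n) (trans (sym hj≡c) (h-toℕ j)) ha~c)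

  open PathRigidity r h h-< h-injective h-link h-link⁻ using (h-fixes)

-- A 3-graph on six vertices

∀-Unique? : ∀ {m n} {P : Vec (Fin m) n → Set} → (∀ v → Dec (P v)) → Dec (∀ v → Unique v → P v)
∀-Unique? {n = zero}  P? = map′ (λ p → λ { [] _ → p }) (λ ∀P → ∀P [] AllPairs.[]) (P? [])
∀-Unique? {n = suc n} P? = map′ (λ ∀P → λ { (x ∷ v) (x∉v ∷ v!) → ∀P v v! x x∉v })
                               (λ ∀P v v! x x∉v → ∀P (x ∷ v) (x∉v ∷ v!))
                               (∀-Unique? λ v → all?ᶠ λ x →
                                 VecAll.all? (λ y → ¬? (x ≟ y)) v →-dec P? (x ∷ v))

fromEdges : ∀ {k m} (Es : List (Subset m)) → All (λ A → ∣ A ∣ ≡ k) Es → KGraph k m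
fromEdges Es sizes = record
  { edge    = λ B → does (B ∈ₗ? Es)
  ; uniform = λ B e → All.lookup sizes (does⇒ (B ∈ₗ? Es) e)
  }

triple : ∀ {m} → Fin m × Fin m × Fin m → Subset m
triple (a , b , c) = ⁅ a ⁆ ∪ ⁅ b ⁆ ∪ ⁅ c ⁆

image-triple : ∀ {m} (φ : Permutation′ m) a b c →
               image φ (triple (a , b , c)) ≡ triple (φ ⟨$⟩ʳ a , φ ⟨$⟩ʳ b , φ ⟨$⟩ʳ c)
image-triple φ a b c = trans (image-∪ φ ⁅ a ⁆ _) (cong₂ _∪_ (image-⁅⁆ φ a) (image-⁅⁆∪⁅⁆ φ b c))

module TripleSystem {m} (ts : List (Fin m × Fin m × Fin m)) (sizes : All (λ t → ∣ triple t ∣ ≡ 3) ts) where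

  graph : KGraph 3 m
  graph = fromEdges (map triple ts) (All.map⁺ sizes)

  MapsTriples : Vec (Fin m) m → Set
  MapsTriples v = All (λ (a , b , c) → triple (lookup v a , lookup v b , lookup v c) ∈ map triple ts) ts

  Rigid : Set
  Rigid = ∀ v → Unique v → MapsTriples v → ∀ i → lookup v i ≡ i

  rigid? : Dec Rigid
  rigid? = ∀-Unique? λ v →
    All.all? (λ (a , b , c) → triple (lookup v a , lookup v b , lookup v c) ∈ₗ? map triple ts) ts
    →-dec all?ᶠ λ i → lookup v i ≟ i

  rigid⇒asymmetric : Rigid → Asymmetric graph
  rigid⇒asymmetric rigid φ aut i =
    trans (sym (lookup∘tabulate _ i)) (rigid v (tabulate⁺ (permutation-injective φ)) maps i)
    where
    v : Vec (Fin m) m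
    v = tabulate (φ ⟨$⟩ʳ_)
    image-edge : ∀ {t} → t ∈ ts → image φ (triple t) ∈ map triple ts
    image-edge t∈ts = does⇒ (_ ∈ₗ? _)
      (trans (automorphism⇒edge-invariant graph φ aut _) (dec-true (_ ∈ₗ? _) (∈-map⁺ triple t∈ts)))
    maps-triple : ∀ a b c → (a , b , c) ∈ ts → triple (lookup v a , lookup v b , lookup v c) ∈ map triple ts
    maps-triple a b c t∈ts
      rewrite lookup∘tabulate (φ ⟨$⟩ʳ_) a | lookup∘tabulate (φ ⟨$⟩ʳ_) b | lookup∘tabulate (φ ⟨$⟩ʳ_) c =
      subst (_∈ map triple ts) (image-triple φ a b c) (image-edge t∈ts)
    maps : MapsTriples v
    maps = All.tabulate λ { {a , b , c} → maps-triple a b c }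

module H = TripleSystem {6} ((# 0 , # 1 , # 2) ∷ (# 0 , # 1 , # 3) ∷ (# 0 , # 2 , # 4) ∷ (# 1 , # 4 , # 5) ∷ [])
                        (refl ∷ refl ∷ refl ∷ refl ∷ [])

H-asymmetric : Asymmetric H.graph
H-asymmetric = H.rigid⇒asymmetric (toWitness {a? = H.rigid?} _)

no-asymmetric-2-graph-on-4 : ¬ Σ (KGraph 2 4) Asymmetric
no-asymmetric-2-graph-on-4 = everyKGraphHasSymmetryIn⇒symmetric (involutions 4)
  (toWitness {a? = everyKGraphHasSymmetryIn? 2 (involutions 4)} _)

no-asymmetric-2-graph-on-5 : ¬ Σ (KGraph 2 5) Asymmetric
no-asymmetric-2-graph-on-5 = everyKGraphHasSymmetryIn⇒symmetric (involutions 5)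
  (toWitness {a? = everyKGraphHasSymmetryIn? 2 (involutions 5)} _)

no-asymmetric-3-graph-on-5 : ¬ Σ (KGraph 3 5) Asymmetric
no-asymmetric-3-graph-on-5 (G , asym) =
  no-asymmetric-2-graph-on-5 (complement refl G , complement-asymmetric refl G asym)

isMinAsymOrder : ∀ {k N} → 2 ≤ k → 2 ≤ N → Σ (KGraph k N) Asymmetric →
                 (∀ d → 2 + k + d < N → ¬ Σ (KGraph k (2 + k + d)) Asymmetric) → IsMinAsymOrder k N
isMinAsymOrder {k} {N} 2≤k 2≤N asymmetric larger = 2≤N , asymmetric , smaller
  where
  smaller : ∀ m → 2 ≤ m → m < N → ¬ Σ (KGraph k m) Asymmetric
  smaller m 2≤m m<N with m ≤? suc k
  ... | yes m≤1+k = few-vertices⇒symmetric 2≤k 2≤m m≤1+k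
  ... | no m≰1+k with m≤n⇒∃[o]m+o≡n (≰⇒> m≰1+k)
  ...   | d , refl = larger d m<N

complement-of-path-asymmetric : ∀ r → Σ (KGraph (4 + r) (6 + r)) Asymmetric
complement-of-path-asymmetric r = complement refl G , complement-asymmetric refl G (pathWithChord-asymmetric r)
  where
  G : KGraph 2 (6 + r)
  G = PathWithChord.graph r

theorem2 : IsMinAsymOrder 2 6 × IsMinAsymOrder 3 6 × ((k : ℕ) → 4 ≤ k → IsMinAsymOrder k (k + 2))
theorem2 = isMinAsymOrder ≤-refl 2≤6 (PathWithChord.graph 0 , pathWithChord-asymmetric 0) larger-2
         , isMinAsymOrder (n≤1+n 2) 2≤6 (H.graph , H-asymmetric) larger-3
         , k+2
  where
  2≤6 : 2 ≤ 6
  2≤6 = s≤s (s≤s z≤n)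
  larger-2 : ∀ d → 4 + d < 6 → ¬ Σ (KGraph 2 (4 + d)) Asymmetric
  larger-2 0 _ = no-asymmetric-2-graph-on-4
  larger-2 1 _ = no-asymmetric-2-graph-on-5
  larger-2 (suc (suc d)) (s≤s (s≤s (s≤s (s≤s (s≤s (s≤s ()))))))
  larger-3 : ∀ d → 5 + d < 6 → ¬ Σ (KGraph 3 (5 + d)) Asymmetric
  larger-3 0 _ = no-asymmetric-3-graph-on-5
  larger-3 (suc d) (s≤s (s≤s (s≤s (s≤s (s≤s (s≤s ()))))))
  k+2 : (k : ℕ) → 4 ≤ k → IsMinAsymOrder k (k + 2)
  k+2 k (s≤s (s≤s (s≤s (s≤s {n = r} _)))) = subst (IsMinAsymOrder k) (+-comm 2 k)
    (isMinAsymOrder (s≤s (s≤s z≤n)) (s≤s (s≤s z≤n)) (complement-of-path-asymmetric r)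
      (λ d 2+k+d<2+k → contradiction 2+k+d<2+k (m+n≮m (2 + k) d)))
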